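{- Let $G$ be a cubic graph of girth at least $8$, and consider the game of cops and robbers on $G$ with three cops, in a position where it is the robber's turn. If the cops have $2$-trapped the robber but have not trapped the robber, then the position is as follows (and in particular $G$ has girth exactly $8$): letting $e_1,e_2,e_3$ be the three edges incident with the robber's vertex $r$, after suitable relabelling, (i) two of the cops each sit at the vertex antipodal to $r$ (at distance $4$ from $r$) on a cycle of length $8$ through $r$; (ii) these two $8$-cycles intersect exactly in the path of length two formed by the edges $e_2$ and $e_3$; (iii) the third cop is at distance $1$ or $2$ from $r$, on a path (of that length) from $r$ that uses the edge $e_1$.
   Context: Cops and robbers: cops are placed first, then the robber; players alternate, cops first; on a turn each pawn stays or moves to an adjacent vertex (all cops may move on the cops' turn); perfect information; the cops win when some cop occupies the robber's vertex. The cops have trapped the robber if for each edge $e$ incident with the robber's vertex there is a cop at distance at most $2$ from the robber along a path that uses the edge $e$. The cops have $2$-trapped the robber (on the robber's turn) if for every move of the robber to an adjacent vertex (i.e. any move other than passing), the cops can respond with a move after which the robber is trapped (or caught). Two vertices are antipodal on a cycle of length $8$ if they are at distance $4$ along the cycle. -}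

module Defs where

open import Data.Nat using (ℕ; suc; _≤_)
open import Data.Fin using (Fin; zero; suc; inject₁; fromℕ)
open import Data.Product using (Σ; ∃; _×_; _,_)
open import Data.Sum using (_⊎_)
open import Relation.Binary.PropositionalEquality using (_≡_; _≢_)
open import Relation.Nullary using (¬_)
open import Function.Definitions using (Injective)

record Graph (n : ℕ) : Set₁ where
  field
    Adj    : Fin n → Fin n → Set
    sym    : ∀ {u v} → Adj u v → Adj v u
    irrefl : ∀ {v} → ¬ Adj v v
open Graph public

module _ {n : ℕ} (G : Graph n) where

  Cubic : Set
  Cubic = ∀ v → Σ (Fin n) λ a → Σ (Fin n) λ b → Σ (Fin n) λ c →
            Adj G v a × Adj G v b × Adj G v c × a ≢ b × a ≢ c × b ≢ c ×
            (∀ w → Adj G v w → w ≡ a ⊎ w ≡ b ⊎ w ≡ c)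

  -- C : Fin (suc m) → Fin n is a cycle of length suc m :
  -- pairwise distinct vertices C 0, C 1, …, C m with C i ~ C (i+1) and C m ~ C 0.
  IsCycle : (m : ℕ) → (Fin (suc m) → Fin n) → Set
  IsCycle m C = Injective _≡_ _≡_ C ×
                (∀ (i : Fin m) → Adj G (C (inject₁ i)) (C (suc i))) ×
                Adj G (C (fromℕ m)) (C zero)

  -- girth at least 8: no cycle of length 3,4,5,6 or 7 (lengths 1,2 are impossible in a simple graph)
  GirthAtLeast8 : Set
  GirthAtLeast8 = ∀ m → 2 ≤ m → m ≤ 6 → (C : Fin (suc m) → Fin n) → ¬ IsCycle m C

  -- The cop at c is at distance at most 2 from the robber at r along a path
  -- (r , a) or (r , a , c) that uses the edge ra.
  Near : Fin n → Fin n → Fin n → Set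
  Near r a c = c ≡ a ⊎ (Adj G a c × c ≢ r)

  Caught : Fin n → (Fin 3 → Fin n) → Set
  Caught r cs = ∃ λ i → cs i ≡ r

  Trapped : Fin n → (Fin 3 → Fin n) → Set
  Trapped r cs = ∀ a → Adj G r a → ∃ λ i → Near r a (cs i)

  Step : Fin n → Fin n → Set
  Step x y = x ≡ y ⊎ Adj G x y

  TwoTrapped : Fin n → (Fin 3 → Fin n) → Set
  TwoTrapped r cs = ∀ r′ → Adj G r r′ →
    Σ (Fin 3 → Fin n) λ cs′ → (∀ i → Step (cs i) (cs′ i)) × (Caught r′ cs′ ⊎ Trapped r′ cs′)

OnCycle : ∀ {n m} → (Fin (suc m) → Fin n) → Fin n → Set
OnCycle C v = ∃ λ i → C i ≡ v

SameEdge : ∀ {n} → Fin n → Fin n → Fin n → Fin n → Set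
SameEdge u v x y = (u ≡ x × v ≡ y) ⊎ (u ≡ y × v ≡ x)

EdgeOf : ∀ {n m} → (Fin (suc m) → Fin n) → Fin n → Fin n → Set
EdgeOf {m = m} C u v = (∃ λ (i : Fin m) → SameEdge u v (C (inject₁ i)) (C (suc i)))
                     ⊎ SameEdge u v (C (fromℕ m)) (C zero)

-- Let a be a neighbour of r whose edge no cop guards. When the robber steps to a, the cops' trapping answer
-- shows that one cop k was within distance 2 of r through another neighbour b, and two cops p, q were at
-- distance 2 or 3 from a through its two other neighbours. In a graph of girth at least 8 two
-- non-backtracking walks that leave a vertex along different edges and meet again have total length at
-- least 8; hence k, p, q are different, so they are all the cops, and none of them guards the third
-- neighbour c. Stepping to c, the robber forces two cops s, t to guard the other edges at c from distance
-- 2 or 3; again s, t ≠ k, so {s, t} = {p, q}. For each of them, the walks from r through a and through c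
-- to it have length at most 4, hence exactly 4 by the girth bound, and they close up to an 8-cycle on which
-- the cop is antipodal to r. The same bound shows that the two 8-cycles share only a, r and c.

module Submission where

open import Defs
open import Data.Fin using (Fin; zero; suc; toℕ; inject₁; fromℕ; #_)
import Data.Fin as Fin
open import Data.Fin.Properties
  using (toℕ-injective; toℕ-inject₁; toℕ-fromℕ; toℕ<n; any?; pigeonhole) renaming (_≟_ to _≟ᶠ_)
open import Data.Nat using (ℕ; zero; suc; _+_; _∸_; _≤_; _<_; z≤n; s≤s; _≤?_)
open import Data.Nat.Properties
open import Data.Product using (Σ; ∃; ∃₂; _×_; _,_; proj₁; proj₂)
open import Data.Sum using (_⊎_; inj₁; inj₂; swap)
open import Data.Empty using (⊥; ⊥-elim)
open import Data.Unit using (tt)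
open import Data.Vec using (Vec; _∷_; []; lookup)
open import Function using (_∘_)
open import Function.Bundles using (_⇔_; mk⇔)
open import Relation.Binary.PropositionalEquality using (_≡_; _≢_; refl; trans; cong; subst; subst₂)
import Relation.Binary.PropositionalEquality as ≡
open import Relation.Nullary using (¬_; Dec; yes; no; contradiction; ¬?)
open import Relation.Nullary.Decidable using (map′; _⊎-dec_; _×-dec_)

module Walks {n : ℕ} (G : Graph n) where

  Walk : Set
  Walk = ℕ → Fin n

  IsWalk : Walk → ℕ → Set
  IsWalk w L = ∀ {i} → i < L → Adj G (w i) (w (suc i))

  NonBacktracking : Walk → ℕ → Set
  NonBacktracking w L = ∀ {i} → 2 + i ≤ L → w i ≢ w (2 + i)

  InjectiveBelow : ℕ → Walk → Set
  InjectiveBelow L w = ∀ {s t} → s < L → t < L → w s ≡ w t → s ≡ t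

  module _ {w : Walk} where

    isWalk-≤ : ∀ {L M} → L ≤ M → IsWalk w M → IsWalk w L
    isWalk-≤ L≤M walk i<L = walk (≤-trans i<L L≤M)

    nonBacktracking-≤ : ∀ {L M} → L ≤ M → NonBacktracking w M → NonBacktracking w L
    nonBacktracking-≤ L≤M nb i+2≤L = nb (≤-trans i+2≤L L≤M)

    isWalk-suc : ∀ {L} → IsWalk w (suc L) → IsWalk (w ∘ suc) L
    isWalk-suc walk i<L = walk (s≤s i<L)

    nonBacktracking-suc : ∀ {L} → NonBacktracking w (suc L) → NonBacktracking (w ∘ suc) L
    nonBacktracking-suc nb i+2≤L = nb (s≤s i+2≤L)

  reverse : Walk → ℕ → Walk
  reverse w L k = w (L ∸ k)

  private
    k+[i+d]∸i≡k+d : ∀ k i d → k + (i + d) ∸ i ≡ k + d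
    k+[i+d]∸i≡k+d k i d = trans (+-∸-assoc k (m≤m+n i d)) (cong (k +_) (m+n∸m≡n i d))

  reverse-isWalk : ∀ {w L} → IsWalk w L → IsWalk (reverse w L) L
  reverse-isWalk {w} walk {i} i<L with m≤n⇒∃[o]m+o≡n i<L
  ... | d , refl = subst₂ (Adj G) (cong w (≡.sym (k+[i+d]∸i≡k+d 1 i d)))
                                  (cong w (≡.sym (k+[i+d]∸i≡k+d 0 i d)))
                                  (sym G (walk (s≤s (m≤n+m d i))))

  reverse-nonBacktracking : ∀ {w L} → NonBacktracking w L → NonBacktracking (reverse w L) L
  reverse-nonBacktracking {w} nb {i} i+2≤L with m≤n⇒∃[o]m+o≡n i+2≤L
  ... | d , refl = λ e → nb (s≤s (s≤s (m≤n+m d i)))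
    (≡.sym (subst₂ _≡_ (cong w (k+[i+d]∸i≡k+d 2 i d)) (cong w (k+[i+d]∸i≡k+d 0 i d)) e))

  _++⟨_⟩_ : Walk → ℕ → Walk → Walk
  (p ++⟨ zero ⟩ q) i = q i
  (p ++⟨ suc S ⟩ q) zero = p zero
  (p ++⟨ suc S ⟩ q) (suc i) = ((p ∘ suc) ++⟨ S ⟩ q) i

  ++-head : ∀ {p q} S → p S ≡ q 0 → (p ++⟨ S ⟩ q) 0 ≡ p 0
  ++-head zero joint = ≡.sym joint
  ++-head (suc S) _ = refl

  ++-right : ∀ {p q} S k → (p ++⟨ S ⟩ q) (S + k) ≡ q k
  ++-right zero k = refl
  ++-right {p} (suc S) k = ++-right {p ∘ suc} S k

  ++-isWalk : ∀ {p q} S {T} → IsWalk p S → IsWalk q T → p S ≡ q 0 → IsWalk (p ++⟨ S ⟩ q) (S + T)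
  ++-isWalk zero walkp walkq joint = walkq
  ++-isWalk {p} (suc S) walkp walkq joint {zero} _ =
    subst (Adj G (p 0)) (≡.sym (++-head {p ∘ suc} S joint)) (walkp (s≤s z≤n))
  ++-isWalk {p} (suc S) walkp walkq joint {suc i} (s≤s i<S+T) =
    ++-isWalk {p ∘ suc} S (isWalk-suc walkp) walkq joint i<S+T

  ++-nonBacktracking : ∀ {p q} s {T} → NonBacktracking p (suc s) → NonBacktracking q T →
                       p (suc s) ≡ q 0 → p s ≢ q 1 → NonBacktracking (p ++⟨ suc s ⟩ q) (suc s + T)
  ++-nonBacktracking zero nbp nbq joint turn {zero} _ = turn
  ++-nonBacktracking zero nbp nbq joint turn {suc i} (s≤s i+2≤T) = nbq i+2≤T
  ++-nonBacktracking {p} (suc s) nbp nbq joint turn {zero} _ e =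
    nbp (s≤s (s≤s z≤n)) (trans e (++-head {λ k → p (2 + k)} s joint))
  ++-nonBacktracking {p} (suc s) nbp nbq joint turn {suc i} (s≤s i+2≤) =
    ++-nonBacktracking {p ∘ suc} s (nonBacktracking-suc nbp) nbq joint turn i+2≤

  injectiveBelow-extend : ∀ {w j} → InjectiveBelow (suc j) w →
                          ¬ (∃ λ i → i < suc j × w i ≡ w (suc j)) → InjectiveBelow (suc (suc j)) w
  injectiveBelow-extend inj fresh (s≤s s≤1+j) (s≤s t≤1+j) e
    with m≤n⇒m<n∨m≡n s≤1+j | m≤n⇒m<n∨m≡n t≤1+j
  ... | inj₁ s<1+j | inj₁ t<1+j = inj s<1+j t<1+j e
  ... | inj₁ s<1+j | inj₂ refl  = ⊥-elim (fresh (_ , s<1+j , e))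
  ... | inj₂ refl  | inj₁ t<1+j = ⊥-elim (fresh (_ , t<1+j , ≡.sym e))
  ... | inj₂ refl  | inj₂ refl  = refl

  first-repeat : ∀ (w : Walk) j → InjectiveBelow (suc j) w ⊎
                ∃₂ λ i k → i < k × k ≤ j × w i ≡ w k × InjectiveBelow k w
  first-repeat w zero = inj₁ λ { (s≤s z≤n) (s≤s z≤n) _ → refl }
  first-repeat w (suc j) with first-repeat w j
  ... | inj₂ (i , k , i<k , k≤j , e , inj) = inj₂ (i , k , i<k , m≤n⇒m≤1+n k≤j , e , inj)
  ... | inj₁ inj with anyUpTo? (λ i → w i ≟ᶠ w (suc j)) (suc j)
  ...   | yes (i , i<1+j , e) = inj₂ (i , suc j , i<1+j , ≤-refl , e , inj)
  ...   | no fresh = inj₁ (injectiveBelow-extend inj fresh)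

  segment-isCycle : ∀ {w} i m → IsWalk w (suc (i + m)) → w i ≡ w (suc (i + m)) →
                    InjectiveBelow (suc (i + m)) w → IsCycle G m (λ f → w (i + toℕ f))
  segment-isCycle {w} i m walk closed inj = injective , step , close
    where
    inside : ∀ (f : Fin (suc m)) → i + toℕ f < suc (i + m)
    inside f = s≤s (+-monoʳ-≤ i (≤-pred (toℕ<n f)))
    injective : ∀ {f g} → w (i + toℕ f) ≡ w (i + toℕ g) → f ≡ g
    injective {f} {g} e = toℕ-injective (+-cancelˡ-≡ i _ _ (inj (inside f) (inside g) e))
    step : ∀ (f : Fin m) → Adj G (w (i + toℕ (inject₁ f))) (w (i + toℕ (suc f)))
    step f rewrite toℕ-inject₁ f | +-suc i (toℕ f) = walk (s≤s (+-monoʳ-≤ i (<⇒≤ (toℕ<n f))))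
    close : Adj G (w (i + toℕ (fromℕ m))) (w (i + 0))
    close rewrite toℕ-fromℕ m | +-identityʳ i = subst (Adj G (w (i + m))) (≡.sym closed) (walk ≤-refl)

  -- NBWalk u v z ℓ : a non-backtracking walk u, v, …, z of length at most ℓ.
  data NBWalk : Fin n → Fin n → Fin n → ℕ → Set where
    [_]    : ∀ {u v ℓ} → Adj G u v → NBWalk u v v (suc ℓ)
    _∷⟨_⟩_ : ∀ {u v w z ℓ} → Adj G u v → u ≢ w → NBWalk v w z ℓ → NBWalk u v z (suc ℓ)

  length : ∀ {u v z ℓ} → NBWalk u v z ℓ → ℕ
  length [ _ ] = 1
  length (_ ∷⟨ _ ⟩ p) = suc (length p)

  vertices : ∀ {u v z ℓ} → NBWalk u v z ℓ → Walk
  vertices {u} _ zero = u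
  vertices {v = v} [ _ ] (suc _) = v
  vertices (_ ∷⟨ _ ⟩ p) (suc i) = vertices p i

  vertices-second : ∀ {u v z ℓ} (p : NBWalk u v z ℓ) → vertices p 1 ≡ v
  vertices-second [ _ ] = refl
  vertices-second (_ ∷⟨ _ ⟩ _) = refl

  vertices-last : ∀ {u v z ℓ} (p : NBWalk u v z ℓ) → vertices p (length p) ≡ z
  vertices-last [ _ ] = refl
  vertices-last (_ ∷⟨ _ ⟩ p) = vertices-last p

  vertices-isWalk : ∀ {u v z ℓ} (p : NBWalk u v z ℓ) → IsWalk (vertices p) (length p)
  vertices-isWalk [ uv ] {zero} _ = uv
  vertices-isWalk [ _ ] {suc _} (s≤s ())
  vertices-isWalk (uv ∷⟨ _ ⟩ _) {zero} _ = uv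
  vertices-isWalk (_ ∷⟨ _ ⟩ p) {suc i} (s≤s i<ℓ) = vertices-isWalk p i<ℓ

  vertices-nonBacktracking : ∀ {u v z ℓ} (p : NBWalk u v z ℓ) →
                             NonBacktracking (vertices p) (length p)
  vertices-nonBacktracking [ _ ] (s≤s ())
  vertices-nonBacktracking {u} (_ ∷⟨ u≢w ⟩ p) {zero} _ =
    subst (u ≢_) (≡.sym (vertices-second p)) u≢w
  vertices-nonBacktracking (_ ∷⟨ _ ⟩ p) {suc i} (s≤s i+2≤ℓ) = vertices-nonBacktracking p i+2≤ℓ

  length-positive : ∀ {u v z ℓ} (p : NBWalk u v z ℓ) → 0 < length p
  length-positive [ _ ] = s≤s z≤n
  length-positive (_ ∷⟨ _ ⟩ _) = s≤s z≤n

  length≤ : ∀ {u v z ℓ} (p : NBWalk u v z ℓ) → length p ≤ ℓ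
  length≤ [ _ ] = s≤s z≤n
  length≤ (_ ∷⟨ _ ⟩ p) = s≤s (length≤ p)

module Girth {n : ℕ} (G : Graph n) (girth : GirthAtLeast8 G) where
  open Walks G

  closedSegment-long : ∀ {w} i m → IsWalk w (suc (i + m)) → NonBacktracking w (suc (i + m)) →
                      w i ≡ w (suc (i + m)) → InjectiveBelow (suc (i + m)) w → 7 ≤ m
  closedSegment-long {w} i zero walk nb closed inj =
    ⊥-elim (irrefl G (subst (Adj G (w i)) (≡.sym (trans closed (cong (w ∘ suc) (+-identityʳ i))))
                              (walk (s≤s (m≤m+n i 0)))))
  closedSegment-long {w} i (suc zero) walk nb closed inj =
    ⊥-elim (nb (≤-reflexive (cong suc (+-comm 1 i))) (trans closed (cong (w ∘ suc) (+-comm i 1))))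
  closedSegment-long i m@(suc (suc _)) walk nb closed inj with m ≤? 6
  ... | yes m≤6 = ⊥-elim (girth m (s≤s (s≤s z≤n)) m≤6 _ (segment-isCycle i m walk closed inj))
  ... | no m≰6 = ≰⇒> m≰6

  closedWalk-long : ∀ {w L} → 0 < L → w 0 ≡ w L → IsWalk w L → NonBacktracking w L →
                    8 ≤ L × InjectiveBelow 8 w
  closedWalk-long {w} {L} 0<L closed walk nb with first-repeat w L
  ... | inj₁ inj = contradiction (inj (s≤s z≤n) (s≤s ≤-refl) closed) (≡.≢-sym (m<n⇒n≢0 0<L))
  ... | inj₂ (i , k , i<k , k≤L , e , inj) with m≤n⇒∃[o]m+o≡n i<k
  ...   | m , refl = ≤-trans 8≤k k≤L , λ s<8 t<8 → inj (≤-trans s<8 8≤k) (≤-trans t<8 8≤k)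
    where
    8≤k : 8 ≤ suc (i + m)
    8≤k = s≤s (≤-trans (closedSegment-long i m (isWalk-≤ k≤L walk) (nonBacktracking-≤ k≤L nb) e inj)
                       (m≤n+m m i))

  -- If the walks reach their meeting point along different edges, p followed by q backwards is a closed
  -- non-backtracking walk; otherwise both can drop their common last step.
  diverging-walks : ∀ {p q} s t → IsWalk p (suc s) → NonBacktracking p (suc s) →
                    IsWalk q (suc t) → NonBacktracking q (suc t) →
                    p 0 ≡ q 0 → p 1 ≢ q 1 → p (suc s) ≡ q (suc t) → 8 ≤ suc s + suc t
  diverging-walks {p} {q} s t walkp nbp walkq nbq start p₁≢q₁ meet with p s ≟ᶠ q t
  ... | no turn = proj₁ (closedWalk-long (s≤s z≤n) closed
                          (++-isWalk (suc s) walkp (reverse-isWalk walkq) meet)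
                          (++-nonBacktracking s nbp (reverse-nonBacktracking nbq) meet turn))
    where
    closed : (p ++⟨ suc s ⟩ reverse q (suc t)) 0 ≡ (p ++⟨ suc s ⟩ reverse q (suc t)) (suc s + suc t)
    closed = trans start (≡.sym (trans (++-right {p} {reverse q (suc t)} (suc s) (suc t))
                                       (cong q (n∸n≡0 t))))
  diverging-walks zero zero _ _ _ _ _ p₁≢q₁ meet | yes _ = ⊥-elim (p₁≢q₁ meet)
  diverging-walks {p} {q} zero (suc t) _ _ walkq nbq start _ _ | yes e =
    ≤-trans (proj₁ (closedWalk-long (s≤s z≤n) (trans (≡.sym start) e) (isWalk-≤ (n≤1+n _) walkq)
                      (nonBacktracking-≤ (n≤1+n _) nbq)))
            (m≤n+m _ 2)
  diverging-walks {p} {q} (suc s) zero walkp nbp _ _ start _ _ | yes e =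
    ≤-trans (proj₁ (closedWalk-long (s≤s z≤n) (trans start (≡.sym e)) (isWalk-≤ (n≤1+n _) walkp)
                      (nonBacktracking-≤ (n≤1+n _) nbp)))
            (≤-trans (n≤1+n _) (m≤m+n _ 1))
  diverging-walks (suc s) (suc t) walkp nbp walkq nbq start p₁≢q₁ _ | yes e =
    ≤-trans (diverging-walks s t (isWalk-≤ (n≤1+n _) walkp) (nonBacktracking-≤ (n≤1+n _) nbp)
                              (isWalk-≤ (n≤1+n _) walkq) (nonBacktracking-≤ (n≤1+n _) nbq) start p₁≢q₁ e)
            (+-mono-≤ (n≤1+n (suc s)) (n≤1+n (suc t)))

  diverging-apart : ∀ {p q L M s t} → IsWalk p L → NonBacktracking p L → IsWalk q M → NonBacktracking q M →
                    p 0 ≡ q 0 → p 1 ≢ q 1 → 0 < s → s ≤ L → 0 < t → t ≤ M → s + t ≤ 7 → p s ≢ q t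
  diverging-apart walkp nbp walkq nbq start p₁≢q₁ (s≤s z≤n) s≤L (s≤s z≤n) t≤M bound meet =
    <⇒≱ (s≤s bound) (diverging-walks _ _ (isWalk-≤ s≤L walkp) (nonBacktracking-≤ s≤L nbp)
                                          (isWalk-≤ t≤M walkq) (nonBacktracking-≤ t≤M nbq) start p₁≢q₁ meet)

  diverge : ∀ {o u v z ℓ ℓ′} → NBWalk o u z ℓ → NBWalk o v z ℓ′ → u ≢ v → ℓ + ℓ′ ≤ 7 → ⊥
  diverge p q u≢v bound =
    diverging-apart (vertices-isWalk p) (vertices-nonBacktracking p)
                    (vertices-isWalk q) (vertices-nonBacktracking q)
      refl (λ e → u≢v (trans (≡.sym (vertices-second p)) (trans e (vertices-second q))))
      (length-positive p) ≤-refl (length-positive q) ≤-refl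
      (≤-trans (+-mono-≤ (length≤ p) (length≤ q)) bound)
      (trans (vertices-last p) (≡.sym (vertices-last q)))

edge-endpoints : ∀ {n m} (C : Fin (suc m) → Fin n) {u v} → EdgeOf C u v → OnCycle C u × OnCycle C v
edge-endpoints C (inj₁ (i , inj₁ (refl , refl))) = (inject₁ i , refl) , (suc i , refl)
edge-endpoints C (inj₁ (i , inj₂ (refl , refl))) = (suc i , refl) , (inject₁ i , refl)
edge-endpoints C (inj₂ (inj₁ (refl , refl))) = (fromℕ _ , refl) , (zero , refl)
edge-endpoints C (inj₂ (inj₂ (refl , refl))) = (zero , refl) , (fromℕ _ , refl)

sameEdge-endpoints : ∀ {n m} {D : Fin (suc m) → Fin n} {u v x y} → SameEdge u v x y →
                     OnCycle D u × OnCycle D v → OnCycle D x × OnCycle D y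
sameEdge-endpoints (inj₁ (refl , refl)) (on-u , on-v) = on-u , on-v
sameEdge-endpoints (inj₂ (refl , refl)) (on-u , on-v) = on-v , on-u

module Octagons {n : ℕ} (G : Graph n) (girth : GirthAtLeast8 G) where
  open Walks G
  open Girth G girth

  octagon : (v₀ v₁ v₂ v₃ v₄ v₅ v₆ v₇ : Fin n) → Walk
  octagon _  v₁ _  _  _  _  _  _  1 = v₁
  octagon _  _  v₂ _  _  _  _  _  2 = v₂
  octagon _  _  _  v₃ _  _  _  _  3 = v₃
  octagon _  _  _  _  v₄ _  _  _  4 = v₄
  octagon _  _  _  _  _  v₅ _  _  5 = v₅
  octagon _  _  _  _  _  _  v₆ _  6 = v₆
  octagon _  _  _  _  _  _  _  v₇ 7 = v₇
  octagon v₀ _  _  _  _  _  _  _  _ = v₀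

  module _ {v₀ v₁ v₂ v₃ v₄ v₅ v₆ v₇ : Fin n} where

    octagon-isWalk : Adj G v₀ v₁ → Adj G v₁ v₂ → Adj G v₂ v₃ → Adj G v₃ v₄ →
                     Adj G v₄ v₅ → Adj G v₅ v₆ → Adj G v₆ v₇ → Adj G v₇ v₀ →
                     IsWalk (octagon v₀ v₁ v₂ v₃ v₄ v₅ v₆ v₇) 8
    octagon-isWalk e₀ _ _ _ _ _ _ _ {0} _ = e₀
    octagon-isWalk _ e₁ _ _ _ _ _ _ {1} _ = e₁
    octagon-isWalk _ _ e₂ _ _ _ _ _ {2} _ = e₂
    octagon-isWalk _ _ _ e₃ _ _ _ _ {3} _ = e₃
    octagon-isWalk _ _ _ _ e₄ _ _ _ {4} _ = e₄
    octagon-isWalk _ _ _ _ _ e₅ _ _ {5} _ = e₅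
    octagon-isWalk _ _ _ _ _ _ e₆ _ {6} _ = e₆
    octagon-isWalk _ _ _ _ _ _ _ e₇ {7} _ = e₇
    octagon-isWalk _ _ _ _ _ _ _ _ {suc (suc (suc (suc (suc (suc (suc (suc _)))))))}
      (s≤s (s≤s (s≤s (s≤s (s≤s (s≤s (s≤s (s≤s ()))))))))

    octagon-nonBacktracking : v₀ ≢ v₂ → v₁ ≢ v₃ → v₂ ≢ v₄ → v₃ ≢ v₅ → v₄ ≢ v₆ → v₅ ≢ v₇ → v₆ ≢ v₀ →
                              NonBacktracking (octagon v₀ v₁ v₂ v₃ v₄ v₅ v₆ v₇) 8
    octagon-nonBacktracking d₀ _ _ _ _ _ _ {0} _ = d₀
    octagon-nonBacktracking _ d₁ _ _ _ _ _ {1} _ = d₁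
    octagon-nonBacktracking _ _ d₂ _ _ _ _ {2} _ = d₂
    octagon-nonBacktracking _ _ _ d₃ _ _ _ {3} _ = d₃
    octagon-nonBacktracking _ _ _ _ d₄ _ _ {4} _ = d₄
    octagon-nonBacktracking _ _ _ _ _ d₅ _ {5} _ = d₅
    octagon-nonBacktracking _ _ _ _ _ _ d₆ {6} _ = d₆
    octagon-nonBacktracking _ _ _ _ _ _ _ {suc (suc (suc (suc (suc (suc (suc _))))))}
      (s≤s (s≤s (s≤s (s≤s (s≤s (s≤s (s≤s (s≤s ()))))))))

  record Octagon (r a x P y c : Fin n) : Set where
    field
      u u′ : Fin n
      isWalk : IsWalk (octagon r a x u P u′ y c) 8
      nonBacktracking : NonBacktracking (octagon r a x u P u′ y c) 8

  module _ {r a x P y c : Fin n} (O : Octagon r a x P y c) where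
    open Octagon O

    walk : Walk
    walk = octagon r a x u P u′ y c

    walk-injective : InjectiveBelow 8 walk
    walk-injective = proj₂ (closedWalk-long (s≤s z≤n) refl isWalk nonBacktracking)

    cycle : Fin 8 → Fin n
    cycle f = walk (toℕ f)

    cycle-isCycle : IsCycle G 7 cycle
    cycle-isCycle = segment-isCycle 0 7 isWalk refl walk-injective

  data Boundary : ℕ → Set where
    at-r : Boundary 0
    at-a : Boundary 1
    at-c : Boundary 7

  consecutive-boundary : ∀ {k} → Boundary k → Boundary (suc k) → k ≡ 0
  consecutive-boundary at-r _ = refl
  consecutive-boundary at-a ()
  consecutive-boundary at-c ()

  -- An interior vertex of the octagon r a x u P u′ y c is reached from r through a (positions 2 to 4) or back
  -- through c (positions 5 and 6); two such routes in two octagons add up to at most 7 steps.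
  data Route (w : Walk) (z : Fin n) : Set where
    through-a : ∀ {s} → s ≤ 2 → w (2 + s) ≡ z → Route w z
    through-c : ∀ {t} → t ≤ 1 → w (6 ∸ t) ≡ z → Route w z

  place : ∀ {w} f → f < 8 → Boundary f ⊎ Route w (w f)
  place 0 _ = inj₁ at-r
  place 1 _ = inj₁ at-a
  place 2 _ = inj₂ (through-a {s = 0} z≤n refl)
  place 3 _ = inj₂ (through-a {s = 1} (s≤s z≤n) refl)
  place 4 _ = inj₂ (through-a {s = 2} (s≤s (s≤s z≤n)) refl)
  place 5 _ = inj₂ (through-c {t = 1} (s≤s z≤n) refl)
  place 6 _ = inj₂ (through-c {t = 0} z≤n refl)
  place 7 _ = inj₁ at-c
  place (suc (suc (suc (suc (suc (suc (suc (suc _))))))))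
    (s≤s (s≤s (s≤s (s≤s (s≤s (s≤s (s≤s (s≤s ()))))))))

  module Crossing {r a x x′ P P′ y y′ c : Fin n} (O : Octagon r a x P y c) (O′ : Octagon r a x′ P′ y′ c)
                  (a≢c : a ≢ c) (x≢x′ : x ≢ x′) (y≢y′ : y ≢ y′) where
    open Octagon using (isWalk; nonBacktracking)

    routes-disjoint : ∀ {z} → Route (walk O) z → Route (walk O′) z → ⊥
    routes-disjoint (through-a s≤2 e) (through-a s′≤2 e′) =
      diverging-apart {p = walk O ∘ suc} {q = walk O′ ∘ suc}
        (isWalk-suc (isWalk O)) (nonBacktracking-suc (nonBacktracking O))
        (isWalk-suc (isWalk O′)) (nonBacktracking-suc (nonBacktracking O′)) refl x≢x′
        (s≤s z≤n) (m≤n⇒m≤o+n 4 (s≤s s≤2)) (s≤s z≤n) (m≤n⇒m≤o+n 4 (s≤s s′≤2))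
        (≤-trans (+-mono-≤ (s≤s s≤2) (s≤s s′≤2)) (n≤1+n 6)) (trans e (≡.sym e′))
    routes-disjoint (through-a s≤2 e) (through-c t≤1 e′) =
      diverging-apart {p = walk O} {q = reverse (walk O′) 8}
        (isWalk O) (nonBacktracking O)
        (reverse-isWalk (isWalk O′)) (reverse-nonBacktracking (nonBacktracking O′)) refl a≢c
        (s≤s z≤n) (m≤n⇒m≤o+n 4 (s≤s (s≤s s≤2))) (s≤s z≤n) (m≤n⇒m≤o+n 5 (s≤s (s≤s t≤1)))
        (+-mono-≤ (s≤s (s≤s s≤2)) (s≤s (s≤s t≤1))) (trans e (≡.sym e′))
    routes-disjoint (through-c t≤1 e) (through-a s≤2 e′) =
      diverging-apart {p = reverse (walk O) 8} {q = walk O′}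
        (reverse-isWalk (isWalk O)) (reverse-nonBacktracking (nonBacktracking O))
        (isWalk O′) (nonBacktracking O′) refl (≡.≢-sym a≢c)
        (s≤s z≤n) (m≤n⇒m≤o+n 5 (s≤s (s≤s t≤1))) (s≤s z≤n) (m≤n⇒m≤o+n 4 (s≤s (s≤s s≤2)))
        (+-mono-≤ (s≤s (s≤s t≤1)) (s≤s (s≤s s≤2))) (trans e (≡.sym e′))
    routes-disjoint (through-c t≤1 e) (through-c t′≤1 e′) =
      diverging-apart {p = reverse (walk O) 7} {q = reverse (walk O′) 7}
        (reverse-isWalk (isWalk-≤ (n≤1+n 7) (isWalk O)))
        (reverse-nonBacktracking (nonBacktracking-≤ (n≤1+n 7) (nonBacktracking O)))
        (reverse-isWalk (isWalk-≤ (n≤1+n 7) (isWalk O′)))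
        (reverse-nonBacktracking (nonBacktracking-≤ (n≤1+n 7) (nonBacktracking O′)))
        refl y≢y′
        (s≤s z≤n) (m≤n⇒m≤o+n 5 (s≤s t≤1)) (s≤s z≤n) (m≤n⇒m≤o+n 5 (s≤s t′≤1))
        (≤-trans (+-mono-≤ (s≤s t≤1) (s≤s t′≤1)) (m≤n+m 4 3)) (trans e (≡.sym e′))

    boundary-shared : ∀ {g} → Boundary g → walk O′ g ≡ walk O g
    boundary-shared at-r = refl
    boundary-shared at-a = refl
    boundary-shared at-c = refl

    common-boundary : ∀ {f g} → f < 8 → g < 8 → walk O f ≡ walk O′ g → Boundary f
    common-boundary {f} {g} f<8 g<8 e with place {walk O} f f<8 | place {walk O′} g g<8
    ... | inj₁ on-f | _ = on-f
    ... | inj₂ _ | inj₁ on-g =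
      subst Boundary (≡.sym (walk-injective O f<8 g<8 (trans e (boundary-shared on-g)))) on-g
    ... | inj₂ route-f | inj₂ route-g =
      ⊥-elim (routes-disjoint route-f (subst (Route (walk O′)) (≡.sym e) route-g))

    boundary-vertex : ∀ {k} → Boundary k → walk O k ≡ a ⊎ walk O k ≡ r ⊎ walk O k ≡ c
    boundary-vertex at-r = inj₂ (inj₁ refl)
    boundary-vertex at-a = inj₁ refl
    boundary-vertex at-c = inj₂ (inj₂ refl)

    shared-vertex : ∀ {v} → OnCycle (cycle O) v → OnCycle (cycle O′) v → v ≡ a ⊎ v ≡ r ⊎ v ≡ c
    shared-vertex (f , refl) (g , e) = boundary-vertex (common-boundary (toℕ<n f) (toℕ<n g) (≡.sym e))

    shared-vertices : ∀ v → (OnCycle (cycle O) v × OnCycle (cycle O′) v) ⇔ (v ≡ a ⊎ v ≡ r ⊎ v ≡ c)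
    shared-vertices v = mk⇔ (λ (on , on′) → shared-vertex on on′) λ where
      (inj₁ refl) → (suc zero , refl) , (suc zero , refl)
      (inj₂ (inj₁ refl)) → (zero , refl) , (zero , refl)
      (inj₂ (inj₂ refl)) → (fromℕ 7 , refl) , (fromℕ 7 , refl)

    first-edge : ∀ (i : Fin 7) → OnCycle (cycle O′) (cycle O (inject₁ i)) →
                 OnCycle (cycle O′) (cycle O (suc i)) → i ≡ zero
    first-edge i (g , e) (h , e′) = toℕ-injective (consecutive-boundary
      (subst Boundary (toℕ-inject₁ i) (common-boundary (toℕ<n (inject₁ i)) (toℕ<n g) (≡.sym e)))
      (common-boundary (toℕ<n (suc i)) (toℕ<n h) (≡.sym e′)))

    shared-edge : ∀ {u v} → EdgeOf (cycle O) u v → EdgeOf (cycle O′) u v →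
                  SameEdge u v r a ⊎ SameEdge u v r c
    shared-edge (inj₂ uv≡cr) _ = inj₂ (swap uv≡cr)
    shared-edge (inj₁ (i , uv≡e)) edge′ with sameEdge-endpoints uv≡e (edge-endpoints (cycle O′) edge′)
    ... | on-x , on-y with first-edge i on-x on-y
    ...   | refl = inj₁ uv≡e

    shared-edges : ∀ u v → (EdgeOf (cycle O) u v × EdgeOf (cycle O′) u v) ⇔
                           (SameEdge u v r a ⊎ SameEdge u v r c)
    shared-edges u v = mk⇔ (λ (e , e′) → shared-edge e e′) λ where
      (inj₁ uv≡ra) → inj₁ (zero , uv≡ra) , inj₁ (zero , uv≡ra)
      (inj₂ uv≡rc) → inj₂ (swap uv≡rc) , inj₂ (swap uv≡rc)

fin3-cover : ∀ (k p q i : Fin 3) → k ≢ p → k ≢ q → p ≢ q → i ≡ k ⊎ i ≡ p ⊎ i ≡ q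
fin3-cover k p q i k≢p k≢q p≢q with i ≟ᶠ k | i ≟ᶠ p | i ≟ᶠ q
... | yes i≡k | _ | _ = inj₁ i≡k
... | no _ | yes i≡p | _ = inj₂ (inj₁ i≡p)
... | no _ | no _ | yes i≡q = inj₂ (inj₂ i≡q)
... | no i≢k | no i≢p | no i≢q = ⊥-elim (four-distinct (pigeonhole (n<1+n 3) (lookup four)))
  where
  four : Vec (Fin 3) 4
  four = i ∷ k ∷ p ∷ q ∷ []
  four-distinct : (∃₂ λ x y → x Fin.< y × lookup four x ≡ lookup four y) → ⊥
  four-distinct (zero , suc zero , _ , e) = i≢k e
  four-distinct (zero , suc (suc zero) , _ , e) = i≢p e
  four-distinct (zero , suc (suc (suc zero)) , _ , e) = i≢q e
  four-distinct (suc zero , suc (suc zero) , _ , e) = k≢p e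
  four-distinct (suc zero , suc (suc (suc zero)) , _ , e) = k≢q e
  four-distinct (suc (suc zero) , suc (suc (suc zero)) , _ , e) = p≢q e
  four-distinct (_ , zero , () , _)
  four-distinct (suc _ , suc zero , s≤s () , _)
  four-distinct (suc (suc _) , suc (suc zero) , s≤s (s≤s ()) , _)
  four-distinct (suc (suc (suc _)) , suc (suc (suc zero)) , s≤s (s≤s (s≤s ())) , _)

module Pursuit {n : ℕ} (G : Graph n) (cubic : Cubic G) (girth : GirthAtLeast8 G) where
  open Walks G
  open Girth G girth
  open Octagons G girth

  adj? : ∀ u z → Dec (Adj G u z)
  adj? u z with cubic u
  ... | x , y , w , ux , uy , uw , _ , _ , _ , only =
    map′ neighbour (only z) (z ≟ᶠ x ⊎-dec z ≟ᶠ y ⊎-dec z ≟ᶠ w)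
    where
    neighbour : z ≡ x ⊎ z ≡ y ⊎ z ≡ w → Adj G u z
    neighbour (inj₁ refl) = ux
    neighbour (inj₂ (inj₁ refl)) = uy
    neighbour (inj₂ (inj₂ refl)) = uw

  near? : ∀ r u z → Dec (Near G r u z)
  near? r u z = z ≟ᶠ u ⊎-dec (adj? u z ×-dec ¬? (z ≟ᶠ r))

  record OtherNeighbours (v u : Fin n) : Set where
    field
      x y : Fin n
      vx : Adj G v x
      vy : Adj G v y
      x≢y : x ≢ y
      x≢u : x ≢ u
      y≢u : y ≢ u
      exhaustive : ∀ w → Adj G v w → w ≡ u ⊎ w ≡ x ⊎ w ≡ y

  other-neighbours : ∀ {v u} → Adj G v u → OtherNeighbours v u
  other-neighbours {v} {u} vu with cubic v
  ... | n₁ , n₂ , n₃ , v₁ , v₂ , v₃ , d₁₂ , d₁₃ , d₂₃ , only with only u vu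
  ... | inj₁ refl = record { x = n₂ ; y = n₃ ; vx = v₂ ; vy = v₃ ; x≢y = d₂₃
                           ; x≢u = ≡.≢-sym d₁₂ ; y≢u = ≡.≢-sym d₁₃ ; exhaustive = only }
  ... | inj₂ (inj₁ refl) = record { x = n₁ ; y = n₃ ; vx = v₁ ; vy = v₃ ; x≢y = d₁₃
                                  ; x≢u = d₁₂ ; y≢u = ≡.≢-sym d₂₃ ; exhaustive = λ w vw → reorder (only w vw) }
    where
    reorder : ∀ {w} → w ≡ n₁ ⊎ w ≡ n₂ ⊎ w ≡ n₃ → w ≡ n₂ ⊎ w ≡ n₁ ⊎ w ≡ n₃
    reorder (inj₁ e) = inj₂ (inj₁ e)
    reorder (inj₂ (inj₁ e)) = inj₁ e
    reorder (inj₂ (inj₂ e)) = inj₂ (inj₂ e)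
  ... | inj₂ (inj₂ refl) = record { x = n₁ ; y = n₂ ; vx = v₁ ; vy = v₂ ; x≢y = d₁₂ ; x≢u = d₁₃ ; y≢u = d₂₃
                                  ; exhaustive = λ w vw → reorder (only w vw) }
    where
    reorder : ∀ {w} → w ≡ n₁ ⊎ w ≡ n₂ ⊎ w ≡ n₃ → w ≡ n₃ ⊎ w ≡ n₁ ⊎ w ≡ n₂
    reorder (inj₁ e) = inj₂ (inj₁ e)
    reorder (inj₂ (inj₁ e)) = inj₂ (inj₂ e)
    reorder (inj₂ (inj₂ e)) = inj₁ e

  Unguarded : Fin n → (Fin 3 → Fin n) → Fin n → Set
  Unguarded r cs a = ∀ i → ¬ Near G r a (cs i)

  unguarded-neighbour : ∀ {r cs} → ¬ Trapped G r cs → ∃ λ a → Adj G r a × Unguarded r cs a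
  unguarded-neighbour {r} {cs} untrapped with cubic r
  ... | n₁ , n₂ , n₃ , r₁ , r₂ , r₃ , _ , _ , _ , only with guarded? n₁ | guarded? n₂ | guarded? n₃
    where
    guarded? : ∀ a → Dec (∃ λ i → Near G r a (cs i))
    guarded? a = any? λ i → near? r a (cs i)
  ... | no free₁ | _ | _ = n₁ , r₁ , λ i near → free₁ (i , near)
  ... | _ | no free₂ | _ = n₂ , r₂ , λ i near → free₂ (i , near)
  ... | _ | _ | no free₃ = n₃ , r₃ , λ i near → free₃ (i , near)
  ... | yes guard₁ | yes guard₂ | yes guard₃ = ⊥-elim (untrapped λ a ra → guard (only a ra))
    where
    guard : ∀ {a} → a ≡ n₁ ⊎ a ≡ n₂ ⊎ a ≡ n₃ → ∃ λ i → Near G r a (cs i)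
    guard (inj₁ refl) = guard₁
    guard (inj₂ (inj₁ refl)) = guard₂
    guard (inj₂ (inj₂ refl)) = guard₃

  -- The cop at z is at distance 2 or 3 from o along a non-backtracking walk starting with the edge ou.
  data Arm (o u z : Fin n) : Set where
    arm₂ : Adj G u z → o ≢ z → Arm o u z
    arm₃ : ∀ {w} → Adj G u w → Adj G w z → o ≢ w → u ≢ z → Arm o u z

  arm-walk : ∀ {o u z} → Adj G o u → Arm o u z → NBWalk o u z 3
  arm-walk ou (arm₂ uz o≢z) = ou ∷⟨ o≢z ⟩ [ uz ]
  arm-walk ou (arm₃ uw wz o≢w u≢z) = ou ∷⟨ o≢w ⟩ (uw ∷⟨ u≢z ⟩ [ wz ])

  arm-walk-from : ∀ {r o u z} → Adj G r o → u ≢ r → Adj G o u → Arm o u z → NBWalk r o z 4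
  arm-walk-from ro u≢r ou arm = ro ∷⟨ ≡.≢-sym u≢r ⟩ arm-walk ou arm

  near-walk : ∀ {r u z} → Adj G r u → Near G r u z → NBWalk r u z 2
  near-walk ru (inj₁ refl) = [ ru ]
  near-walk ru (inj₂ (uz , z≢r)) = ru ∷⟨ ≡.≢-sym z≢r ⟩ [ uz ]

  stepped-onto : ∀ {r w z} → Step G z w → z ≢ r → Near G r w z
  stepped-onto (inj₁ refl) _ = inj₁ refl
  stepped-onto (inj₂ zw) z≢r = inj₂ (sym G zw , z≢r)

  approach : ∀ {o u z z′} → Adj G o u → Near G o u z′ → Step G z z′ → z ≢ o → ¬ Adj G o z → Arm o u z
  approach ou (inj₁ refl) (inj₁ refl) _ o≁z = ⊥-elim (o≁z ou)
  approach ou (inj₁ refl) (inj₂ zu) z≢o _ = arm₂ (sym G zu) (≡.≢-sym z≢o)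
  approach ou (inj₂ (uz , z≢o)) (inj₁ refl) _ _ = arm₂ uz (≡.≢-sym z≢o)
  approach {o} ou (inj₂ (uz′ , z′≢o)) (inj₂ zz′) _ o≁z =
    arm₃ uz′ (sym G zz′) (≡.≢-sym z′≢o) λ { refl → o≁z ou }

  guard-back : ∀ {r a z z′} → Near G a r z′ → Step G z z′ → z ≢ r → ∃ λ w → Adj G r w × Near G r w z
  guard-back (inj₁ refl) (inj₁ refl) z≢r = ⊥-elim (z≢r refl)
  guard-back (inj₁ refl) (inj₂ zr) _ = _ , sym G zr , inj₁ refl
  guard-back (inj₂ (rz′ , _)) step z≢r = _ , rz′ , stepped-onto step z≢r

  record Arms (r o : Fin n) (cs : Fin 3 → Fin n) (i j : Fin 3) : Set where
    field
      x y : Fin n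
      ox : Adj G o x
      oy : Adj G o y
      x≢y : x ≢ y
      x≢r : x ≢ r
      y≢r : y ≢ r
      arm-x : Arm o x (cs i)
      arm-y : Arm o y (cs j)

  swap-arms : ∀ {r o cs i j} → Arms r o cs i j → Arms r o cs j i
  swap-arms A = record { x = y ; y = x ; ox = oy ; oy = ox ; x≢y = ≡.≢-sym x≢y ; x≢r = y≢r ; y≢r = x≢r
                       ; arm-x = arm-y ; arm-y = arm-x }
    where open Arms A

  -- What the cops' trapping answer to the robber's move from r to o reveals about their positions before it.
  record Response (r o : Fin n) (cs : Fin 3 → Fin n) : Set where
    field
      p q k : Fin 3
      arms : Arms r o cs p q
      w : Fin n
      rw : Adj G r w
      near-k : Near G r w (cs k)

  respond : ∀ {r o cs} → (∀ i → cs i ≢ r) → TwoTrapped G r cs → Adj G r o → Unguarded r cs o →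
            Response r o cs
  respond {r} {o} {cs} free twoTrapped ro unguarded = response (twoTrapped o ro)
    where
    open OtherNeighbours (other-neighbours (sym G ro))
    away : ∀ i → cs i ≢ o
    away i e = unguarded i (inj₁ e)
    nonadjacent : ∀ i → ¬ Adj G o (cs i)
    nonadjacent i oc = unguarded i (inj₂ (oc , free i))
    response : (Σ (Fin 3 → Fin n) λ cs′ → (∀ i → Step G (cs i) (cs′ i)) × (Caught G o cs′ ⊎ Trapped G o cs′)) →
               Response r o cs
    response (_ , steps , inj₁ (i , caught)) =
      ⊥-elim (unguarded i (stepped-onto (subst (Step G (cs i)) caught (steps i)) (free i)))
    response (_ , steps , inj₂ trapped) with trapped r (sym G ro) | trapped x vx | trapped y vy
    ... | k , guard-k | p , guard-p | q , guard-q with guard-back guard-k (steps k) (free k)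
    ... | w , rw , near-k = record
      { p = p ; q = q ; k = k ; w = w ; rw = rw ; near-k = near-k
      ; arms = record { x = x ; y = y ; ox = vx ; oy = vy ; x≢y = x≢y ; x≢r = x≢u ; y≢r = y≢u
                      ; arm-x = approach vx guard-p (steps p) (away p) (nonadjacent p)
                      ; arm-y = approach vy guard-q (steps q) (away q) (nonadjacent q) } }

  octagon-through : ∀ {r a c x y P} → Adj G r a → Adj G r c → a ≢ c → Adj G a x → x ≢ r → Adj G c y → y ≢ r →
                    Arm a x P → Arm c y P → Octagon r a x P y c
  octagon-through ra rc a≢c ax x≢r cy y≢r (arm₂ xP a≢P) arm-c =
    ⊥-elim (diverge {ℓ = 3} (ra ∷⟨ ≡.≢-sym x≢r ⟩ (ax ∷⟨ a≢P ⟩ [ xP ])) (arm-walk-from rc y≢r cy arm-c)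
                    a≢c (≤ᵇ⇒≤ 7 7 tt))
  octagon-through ra rc a≢c ax x≢r cy y≢r arm-a (arm₂ yP c≢P) =
    ⊥-elim (diverge {ℓ′ = 3} (arm-walk-from ra x≢r ax arm-a) (rc ∷⟨ ≡.≢-sym y≢r ⟩ (cy ∷⟨ c≢P ⟩ [ yP ]))
                    a≢c (≤ᵇ⇒≤ 7 7 tt))
  octagon-through ra rc a≢c ax x≢r cy y≢r (arm₃ {u} xu uP a≢u x≢P) (arm₃ {u′} yu′ u′P c≢u′ y≢P)
    with u ≟ᶠ u′
  ... | yes refl = ⊥-elim (diverge {ℓ = 3} {ℓ′ = 3} (ra ∷⟨ ≡.≢-sym x≢r ⟩ (ax ∷⟨ a≢u ⟩ [ xu ]))
                                   (rc ∷⟨ ≡.≢-sym y≢r ⟩ (cy ∷⟨ c≢u′ ⟩ [ yu′ ])) a≢c (≤ᵇ⇒≤ 6 7 tt))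
  ... | no u≢u′ = record
    { u = u ; u′ = u′
    ; isWalk = octagon-isWalk ra ax xu uP (sym G u′P) (sym G yu′) (sym G cy) (sym G rc)
    ; nonBacktracking =
        octagon-nonBacktracking (≡.≢-sym x≢r) a≢u x≢P u≢u′ (≡.≢-sym y≢P) (≡.≢-sym c≢u′) y≢r }

  AntipodalPosition : Fin n → (Fin 3 → Fin n) → Set
  AntipodalPosition r cs =
    Σ (Fin n) λ a₁ → Σ (Fin n) λ a₂ → Σ (Fin n) λ a₃ →
      Adj G r a₁ × Adj G r a₂ × Adj G r a₃ × a₁ ≢ a₂ × a₁ ≢ a₃ × a₂ ≢ a₃ ×
      Σ (Fin 3) λ i → Σ (Fin 3) λ j → Σ (Fin 3) λ k →
        i ≢ j × i ≢ k × j ≢ k ×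
        Σ (Fin 8 → Fin n) λ C → Σ (Fin 8 → Fin n) λ D →
          IsCycle G 7 C × IsCycle G 7 D ×
          C zero ≡ r × D zero ≡ r ×
          cs i ≡ C (# 4) × cs j ≡ D (# 4) ×
          (∀ v → (OnCycle C v × OnCycle D v) ⇔ (v ≡ a₂ ⊎ v ≡ r ⊎ v ≡ a₃)) ×
          (∀ u v → (EdgeOf C u v × EdgeOf D u v) ⇔ (SameEdge u v r a₂ ⊎ SameEdge u v r a₃)) ×
          Near G r a₁ (cs k)

  antipodal-position : ∀ {r cs a b c s t k} → Adj G r a → Adj G r b → Adj G r c → b ≢ a → b ≢ c → a ≢ c →
                      s ≢ t → s ≢ k → t ≢ k → Near G r b (cs k) → Arms r a cs s t → Arms r c cs s t →
                      AntipodalPosition r cs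
  antipodal-position {s = s} {t} {k} ra rb rc b≢a b≢c a≢c s≢t s≢k t≢k near-k A C =
    _ , _ , _ , rb , ra , rc , b≢a , b≢c , a≢c , s , t , k , s≢t , s≢k , t≢k ,
    cycle O , cycle O′ , cycle-isCycle O , cycle-isCycle O′ , refl , refl , refl , refl ,
    shared-vertices , shared-edges , near-k
    where
    open Arms
    O = octagon-through ra rc a≢c (ox A) (x≢r A) (ox C) (x≢r C) (arm-x A) (arm-x C)
    O′ = octagon-through ra rc a≢c (oy A) (y≢r A) (oy C) (y≢r C) (arm-y A) (arm-y C)
    open Crossing O O′ a≢c (x≢y A) (x≢y C)

  module _ {r : Fin n} {cs : Fin 3 → Fin n} (free : ∀ i → cs i ≢ r) (twoTrapped : TwoTrapped G r cs) where

    distinct-cops : ∀ {i j o u v ℓ ℓ′} → NBWalk o u (cs i) ℓ → NBWalk o v (cs j) ℓ′ → u ≢ v → ℓ + ℓ′ ≤ 7 →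
                    i ≢ j
    distinct-cops p q u≢v bound refl = diverge p q u≢v bound

    module AfterFirstMove {a b c} (ra : Adj G r a) (rb : Adj G r b) (rc : Adj G r c)
                          (b≢a : b ≢ a) (b≢c : b ≢ c) (a≢c : a ≢ c)
                          (R : Response r a cs) (near-k : Near G r b (cs (Response.k R))) where
      open Response R using (p; q; k; arms)
      open Arms arms

      walk-k : NBWalk r b (cs k) 2
      walk-k = near-walk rb near-k

      walk-p : NBWalk r a (cs p) 4
      walk-p = arm-walk-from ra x≢r ox arm-x

      walk-q : NBWalk r a (cs q) 4
      walk-q = arm-walk-from ra y≢r oy arm-y

      k≢p : k ≢ p
      k≢p = distinct-cops walk-k walk-p b≢a (≤ᵇ⇒≤ 6 7 tt)

      k≢q : k ≢ q
      k≢q = distinct-cops walk-k walk-q b≢a (≤ᵇ⇒≤ 6 7 tt)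

      p≢q : p ≢ q
      p≢q = distinct-cops (arm-walk ox arm-x) (arm-walk oy arm-y) x≢y (≤ᵇ⇒≤ 6 7 tt)

      every-cop : ∀ i → i ≡ k ⊎ i ≡ p ⊎ i ≡ q
      every-cop i = fin3-cover k p q i k≢p k≢q p≢q

      unguarded-c : Unguarded r cs c
      unguarded-c i near with every-cop i
      ... | inj₁ refl = diverge walk-k (near-walk rc near) b≢c (≤ᵇ⇒≤ 4 7 tt)
      ... | inj₂ (inj₁ refl) = diverge walk-p (near-walk rc near) a≢c (≤ᵇ⇒≤ 6 7 tt)
      ... | inj₂ (inj₂ refl) = diverge walk-q (near-walk rc near) a≢c (≤ᵇ⇒≤ 6 7 tt)

      R′ : Response r c cs
      R′ = respond free twoTrapped rc unguarded-c

      open Response R′ using () renaming (p to s; q to t; arms to arms-c)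
      open Arms arms-c using ()
        renaming (x to c₁; y to c₂; ox to cc₁; oy to cc₂; x≢y to c₁≢c₂; x≢r to c₁≢r; y≢r to c₂≢r;
                  arm-x to arm-s; arm-y to arm-t)

      s≢k : s ≢ k
      s≢k = distinct-cops (arm-walk-from rc c₁≢r cc₁ arm-s) walk-k (≡.≢-sym b≢c) (≤ᵇ⇒≤ 6 7 tt)

      t≢k : t ≢ k
      t≢k = distinct-cops (arm-walk-from rc c₂≢r cc₂ arm-t) walk-k (≡.≢-sym b≢c) (≤ᵇ⇒≤ 6 7 tt)

      s≢t : s ≢ t
      s≢t = distinct-cops (arm-walk cc₁ arm-s) (arm-walk cc₂ arm-t) c₁≢c₂ (≤ᵇ⇒≤ 6 7 tt)

      arms-a : Arms r a cs s t
      arms-a with every-cop s | every-cop t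
      ... | inj₁ s≡k | _ = ⊥-elim (s≢k s≡k)
      ... | _ | inj₁ t≡k = ⊥-elim (t≢k t≡k)
      ... | inj₂ (inj₁ s≡p) | inj₂ (inj₂ t≡q) = subst₂ (Arms r a cs) (≡.sym s≡p) (≡.sym t≡q) arms
      ... | inj₂ (inj₂ s≡q) | inj₂ (inj₁ t≡p) = subst₂ (Arms r a cs) (≡.sym s≡q) (≡.sym t≡p) (swap-arms arms)
      ... | inj₂ (inj₁ s≡p) | inj₂ (inj₁ t≡p) = ⊥-elim (s≢t (trans s≡p (≡.sym t≡p)))
      ... | inj₂ (inj₂ s≡q) | inj₂ (inj₂ t≡q) = ⊥-elim (s≢t (trans s≡q (≡.sym t≡q)))

      position : AntipodalPosition r cs
      position = antipodal-position ra rb rc b≢a b≢c a≢c s≢t s≢k t≢k near-k arms-a arms-c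

    untrapped⇒antipodal : ¬ Trapped G r cs → AntipodalPosition r cs
    untrapped⇒antipodal untrapped with unguarded-neighbour untrapped
    ... | a , ra , unguarded-a = guard-of-ra (exhaustive w rw)
      where
      open OtherNeighbours (other-neighbours ra)
      R = respond free twoTrapped ra unguarded-a
      open Response R using (w; rw; k; near-k)
      near-k-at : ∀ {v} → w ≡ v → Near G r v (cs k)
      near-k-at refl = near-k
      guard-of-ra : w ≡ a ⊎ w ≡ x ⊎ w ≡ y → AntipodalPosition r cs
      guard-of-ra (inj₁ w≡a) = ⊥-elim (unguarded-a k (near-k-at w≡a))
      guard-of-ra (inj₂ (inj₁ w≡x)) =
        AfterFirstMove.position ra vx vy x≢u x≢y (≡.≢-sym y≢u) R (near-k-at w≡x)
      guard-of-ra (inj₂ (inj₂ w≡y)) =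
        AfterFirstMove.position ra vy vx y≢u (≡.≢-sym x≢y) (≡.≢-sym x≢u) R (near-k-at w≡y)

lemma4p1 : ∀ {n} (G : Graph n) → Cubic G → GirthAtLeast8 G →
    (r : Fin n) (cs : Fin 3 → Fin n) →
    ¬ Caught G r cs → TwoTrapped G r cs → ¬ Trapped G r cs →
    Σ (Fin n) λ a₁ → Σ (Fin n) λ a₂ → Σ (Fin n) λ a₃ →
      Adj G r a₁ × Adj G r a₂ × Adj G r a₃ × a₁ ≢ a₂ × a₁ ≢ a₃ × a₂ ≢ a₃ ×
      Σ (Fin 3) λ i → Σ (Fin 3) λ j → Σ (Fin 3) λ k →
        i ≢ j × i ≢ k × j ≢ k ×
        Σ (Fin 8 → Fin n) λ C → Σ (Fin 8 → Fin n) λ D →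
          IsCycle G 7 C × IsCycle G 7 D ×
          C zero ≡ r × D zero ≡ r ×
          cs i ≡ C (# 4) × cs j ≡ D (# 4) ×
          (∀ v → (OnCycle C v × OnCycle D v) ⇔ (v ≡ a₂ ⊎ v ≡ r ⊎ v ≡ a₃)) ×
          (∀ u v → (EdgeOf C u v × EdgeOf D u v) ⇔ (SameEdge u v r a₂ ⊎ SameEdge u v r a₃)) ×
          Near G r a₁ (cs k)
lemma4p1 G cubic girth r cs uncaught twoTrapped untrapped =
  Pursuit.untrapped⇒antipodal G cubic girth (λ i e → uncaught (i , e)) twoTrapped untrapped
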